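{- Let $(X,C)$ be an instance of 3SAT (variable set $X$, set $C$ of clauses each with exactly three literals). If the graph $G_{X,C}$ has a connected matching of weight $|X|+|C|$, then $C$ has a satisfying truth assignment.
   Context: The edge-weighted graph $G_{X,C}$ is built as follows. (I) For each variable $x_i\in X$, add a triangle on vertices $x_i,x_i^+,x_i^-$, with $w(x_i^+x_i^-)=-1$ and $w(x_ix_i^+)=w(x_ix_i^-)=+1$. (II) For each pair of distinct variables $x_i,x_j$, add all edges between $\{x_i^-,x_i^+\}$ and $\{x_j^-,x_j^+\}$, each of weight $-1$. (III) For each clause $c_i\in C$, add an edge $c_i^+c_i^-$ of weight $+1$, and for each literal of $c_i$ on variable $x_j$, add edges of weight $-1$ from both $c_i^-$ and $c_i^+$ to $x_j^-$ if the literal is negated, and to $x_j^+$ otherwise. For a matching $M$, $V(M)$ is the set of endpoints of its edges, $M$ is connected if the induced subgraph $G_{X,C}[V(M)]$ is connected, and its weight is the sum of its edge weights. -}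

module Defs where

open import Data.Nat using (ℕ)
open import Data.Bool using (Bool; true; false)
open import Data.Fin using (Fin; _<_)
open import Data.Vec using (Vec; lookup)
open import Data.Integer using (ℤ; +_; -[1+_]; _+_)
open import Data.List using (List; []; _∷_; concatMap; map; foldr)
open import Data.List.Membership.Propositional using (_∈_)
open import Data.List.Relation.Unary.Unique.Propositional using (Unique)
open import Data.Product using (Σ; _×_; _,_; proj₁; proj₂; ∃)
open import Data.Sum using (_⊎_)
open import Relation.Binary.PropositionalEquality using (_≡_)

-- A literal over variables Fin n: (sign , variable); sign true = positive
-- literal x, sign false = negated literal ¬x.
Literal : ℕ → Set
Literal n = Bool × Fin n

Clause : ℕ → Set
Clause n = Vec (Literal n) 3

Instance : ℕ → ℕ → Set
Instance n m = Fin m → Clause n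

-- Vertices of G_{X,C}:
--   var i     = x_i
--   lit true i  = x_i^+ ,  lit false i = x_i^-
--   cl true j   = c_j^+ ,  cl false j  = c_j^-
data Vertex (n m : ℕ) : Set where
  var : Fin n → Vertex n m
  lit : Bool → Fin n → Vertex n m
  cl  : Bool → Fin m → Vertex n m

litVertex : ∀ {n m} → Literal n → Vertex n m
litVertex (s , v) = lit s v

-- Edges of G_{X,C}, each undirected edge listed in (at least) one orientation.
data Edge {n m : ℕ} (C : Instance n m) : Vertex n m → Vertex n m → Set where
  var-pos  : (i : Fin n) → Edge C (var i) (lit true i)
  var-neg  : (i : Fin n) → Edge C (var i) (lit false i)
  pos-neg  : (i : Fin n) → Edge C (lit true i) (lit false i)
  lit-lit  : (i j : Fin n) → i < j → (s t : Bool) → Edge C (lit s i) (lit t j)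
  cl-cl    : (j : Fin m) → Edge C (cl true j) (cl false j)
  cl-lit   : (j : Fin m) → (k : Fin 3) → (s : Bool) →
             Edge C (cl s j) (litVertex (lookup (C j) k))

weight : ∀ {n m} {C : Instance n m} {u v : Vertex n m} → Edge C u v → ℤ
weight (var-pos i)         = + 1
weight (var-neg i)         = + 1
weight (pos-neg i)         = -[1+ 0 ]
weight (lit-lit i j _ s t) = -[1+ 0 ]
weight (cl-cl j)           = + 1
weight (cl-lit j k s)      = -[1+ 0 ]

Adj : ∀ {n m} → Instance n m → Vertex n m → Vertex n m → Set
Adj C u v = Edge C u v ⊎ Edge C v u

EdgeOf : ∀ {n m} → Instance n m → Set
EdgeOf {n} {m} C = Σ (Vertex n m × Vertex n m) λ uv → Edge C (proj₁ uv) (proj₂ uv)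

endpoints : ∀ {n m} {C : Instance n m} → List (EdgeOf C) → List (Vertex n m)
endpoints = concatMap (λ e → proj₁ (proj₁ e) ∷ proj₂ (proj₁ e) ∷ [])

IsMatching : ∀ {n m} {C : Instance n m} → List (EdgeOf C) → Set
IsMatching M = Unique (endpoints M)

matchingWeight : ∀ {n m} {C : Instance n m} → List (EdgeOf C) → ℤ
matchingWeight M = foldr (λ e acc → weight (proj₂ e) + acc) (+ 0) M

data InducedPath {n m} (C : Instance n m) (S : Vertex n m → Set) :
                 Vertex n m → Vertex n m → Set where
  here : ∀ {u} → S u → InducedPath C S u u
  step : ∀ {u v w} → S u → Adj C u v → InducedPath C S v w → InducedPath C S u w

InducedConnected : ∀ {n m} (C : Instance n m) → (Vertex n m → Set) → Set
InducedConnected C S = ∀ u v → S u → S v → InducedPath C S u v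

ConnectedMatching : ∀ {n m} {C : Instance n m} → List (EdgeOf C) → Set
ConnectedMatching {C = C} M = IsMatching M × InducedConnected C (λ v → v ∈ endpoints M)

LitTrue : ∀ {n} → (Fin n → Bool) → Literal n → Set
LitTrue α (s , v) = α v ≡ s

Satisfies : ∀ {n m} → (Fin n → Bool) → Instance n m → Set
Satisfies α C = ∀ j → ∃ λ k → LitTrue α (lookup (C j) k)

Satisfiable : ∀ {n m} → Instance n m → Set
Satisfiable {n} C = ∃ λ (α : Fin n → Bool) → Satisfies α C

-- An edge of weight +1 is a triangle edge x_i x_i^± or an edge c_j⁺c_j⁻; call
-- x_i resp. c_j⁺ its owner.  Every unowned edge has weight −1.  In a matching,
-- distinct owned edges have distinct owners, so there are at most |X| + |C| of
-- them, and weight |X| + |C| forces a matching without unowned edges in which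
-- every x_i and every c_j⁺ is covered.  Each covered literal vertex x_i^± is
-- then matched to x_i, so at most one of x_i⁺, x_i⁻ is covered, and setting x_i
-- true iff x_i⁺ is covered makes every covered literal vertex true.  Finally, a
-- path in G[V(M)] from c_j⁺ to x_i must leave {c_j⁺, c_j⁻} along an edge to a
-- covered literal vertex of c_j, which is a true literal of c_j.
module Submission where

open import Defs
open import Data.Bool using (Bool; true; false)
open import Data.Bool.Properties using () renaming (_≟_ to _≟ᵇ_)
open import Data.Fin using (Fin; zero; suc)
open import Data.Fin.Properties using (injective⇒≤; +↔⊎) renaming (_≟_ to _≟ᶠ_)
open import Data.Integer using (+_; -[1+_]) renaming (_+_ to _+ℤ_)
open import Data.Integer.Properties using (+-injective; +-assoc)
open import Data.Integer.Tactic.RingSolver using (solve-∀)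
open import Data.List using (List; []; _∷_; length; lookup; mapMaybe)
open import Data.List.Membership.Propositional using (_∈_; _∉_)
open import Data.List.Membership.Propositional.Properties using (∈-lookup)
import Data.List.Membership.DecPropositional as DecMembership
import Data.List.Relation.Unary.All as All
open import Data.List.Relation.Unary.All.Properties using (¬Any⇒All¬)
open import Data.List.Relation.Unary.AllPairs using ([]; _∷_)
open import Data.List.Relation.Unary.Any using (here; there)
open import Data.List.Relation.Unary.Unique.Propositional using (Unique)
open import Data.List.Relation.Unary.Unique.Propositional.Properties using (Unique[x∷xs]⇒x∉xs)
open import Data.Maybe using (Maybe; just; nothing)
open import Data.Nat using (ℕ; suc; _+_; _≤_)
open import Data.Nat.Properties
  using (<-irrefl; ≤-antisym; m≤m+n; n≤0⇒n≡0; +-cancelˡ-≤; +-identityʳ; module ≤-Reasoning)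
open import Data.Product using (_×_; _,_; proj₂; ∃)
import Data.Product.Properties as Product
open import Data.Sum using (_⊎_; inj₁; inj₂; [_,_]′)
import Data.Sum.Properties as Sum
open import Data.Vec using () renaming (lookup to lookupᵛ)
open import Function using (_∘_; _↣_; Injection; mk↣)
open import Function.Definitions using (Injective)
open import Function.Properties.Inverse using (↔⇒↣; ↔-sym)
open import Relation.Binary.Definitions using (DecidableEquality)
open import Relation.Binary.PropositionalEquality using (_≡_; _≢_; refl; sym; trans; cong; subst)
open import Relation.Nullary using (does; contradiction)
open import Relation.Nullary.Decidable using (via-injection; decidable-stable; dec-true; dec-false)

lookup-injective : ∀ {a} {A : Set a} {xs : List A} → Unique xs → Injective _≡_ _≡_ (lookup xs)
lookup-injective (_  ∷ _)   {zero}  {zero}  _  = refl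
lookup-injective (x∉ ∷ _)   {zero}  {suc j} eq = contradiction eq (All.lookup x∉ (∈-lookup j))
lookup-injective (x∉ ∷ _)   {suc i} {zero}  eq = contradiction (sym eq) (All.lookup x∉ (∈-lookup i))
lookup-injective (_  ∷ uq)  {suc i} {suc j} eq = cong suc (lookup-injective uq eq)

module _ {a} {A : Set a} {k : ℕ} (ι : A ↣ Fin k) where
  open Injection ι using (injective)

  Unique⇒length≤ : ∀ {xs : List A} → Unique xs → length xs ≤ k
  Unique⇒length≤ uq = injective⇒≤ (lookup-injective uq ∘ injective)

  Unique∧length≡⇒∈ : ∀ {xs : List A} → Unique xs → length xs ≡ k → ∀ y → y ∈ xs
  Unique∧length≡⇒∈ {xs} uq len y = decidable-stable (y ∈? xs) λ y∉xs →
    <-irrefl len (Unique⇒length≤ (¬Any⇒All¬ xs y∉xs ∷ uq))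
    where open DecMembership (via-injection ι _≟ᶠ_) using (_∈?_)

module _ {n m : ℕ} where

  private
    Code : Set
    Code = Fin n ⊎ (Bool × Fin n) ⊎ (Bool × Fin m)

    encode : Vertex n m → Code
    encode (var i)   = inj₁ i
    encode (lit s i) = inj₂ (inj₁ (s , i))
    encode (cl s j)  = inj₂ (inj₂ (s , j))

    decode : Code → Vertex n m
    decode (inj₁ i)                = var i
    decode (inj₂ (inj₁ (s , i)))   = lit s i
    decode (inj₂ (inj₂ (s , j)))   = cl s j

    decode-encode : ∀ v → decode (encode v) ≡ v
    decode-encode (var i)   = refl
    decode-encode (lit s i) = refl
    decode-encode (cl s j)  = refl

    encode-injective : Injective _≡_ _≡_ encode
    encode-injective {u} {v} eq =
      trans (sym (decode-encode u)) (trans (cong decode eq) (decode-encode v))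

    _≟ᶜ_ : DecidableEquality Code
    _≟ᶜ_ = Sum.≡-dec _≟ᶠ_
             (Sum.≡-dec (Product.≡-dec _≟ᵇ_ _≟ᶠ_) (Product.≡-dec _≟ᵇ_ _≟ᶠ_))

  _≟ᵛ_ : DecidableEquality (Vertex n m)
  _≟ᵛ_ = via-injection (mk↣ encode-injective) _≟ᶜ_

module _ {n m : ℕ} {C : Instance n m} where

  owner : ∀ {u v} → Edge C u v → Maybe (Fin n ⊎ Fin m)
  owner (var-pos i)         = just (inj₁ i)
  owner (var-neg i)         = just (inj₁ i)
  owner (cl-cl j)           = just (inj₂ j)
  owner (pos-neg i)         = nothing
  owner (lit-lit i j _ s t) = nothing
  owner (cl-lit j k s)      = nothing

  ownerVertex : Fin n ⊎ Fin m → Vertex n m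
  ownerVertex = [ var , cl true ]′

  owner-source : ∀ {u v o} (e : Edge C u v) → owner e ≡ just o → ownerVertex o ≡ u
  owner-source (var-pos i) refl = refl
  owner-source (var-neg i) refl = refl
  owner-source (cl-cl j)   refl = refl

  weight-owned : ∀ {u v o} (e : Edge C u v) → owner e ≡ just o → weight e ≡ + 1
  weight-owned (var-pos i) refl = refl
  weight-owned (var-neg i) refl = refl
  weight-owned (cl-cl j)   refl = refl

  weight-unowned : ∀ {u v} (e : Edge C u v) → owner e ≡ nothing → weight e ≡ -[1+ 0 ]
  weight-unowned (pos-neg i)         refl = refl
  weight-unowned (lit-lit i j _ s t) refl = refl
  weight-unowned (cl-lit j k s)      refl = refl

  owned-source-not-literal : ∀ {u v o s i} (e : Edge C u v) → owner e ≡ just o → lit s i ≢ u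
  owned-source-not-literal (var-pos i) refl ()
  owned-source-not-literal (var-neg i) refl ()
  owned-source-not-literal (cl-cl j)   refl ()

  owned-literal-source : ∀ {u v o s i} (e : Edge C u v) → owner e ≡ just o →
                         lit s i ≡ v → var i ≡ u
  owned-literal-source (var-pos i) refl refl = refl
  owned-literal-source (var-neg i) refl refl = refl
  owned-literal-source (cl-cl j)   refl ()

  owners : List (EdgeOf C) → List (Fin n ⊎ Fin m)
  owners = mapMaybe (owner ∘ proj₂)

  unownedCount : List (EdgeOf C) → ℕ
  unownedCount [] = 0
  unownedCount ((_ , e) ∷ M) with owner e
  ... | just _  = unownedCount M
  ... | nothing = suc (unownedCount M)

  owners⊆endpoints : ∀ M {o} → o ∈ owners M → ownerVertex o ∈ endpoints M
  owners⊆endpoints ((_ , e) ∷ M) o∈ with owner e in eq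
  owners⊆endpoints ((_ , e) ∷ M) (here refl) | just _  = here (owner-source e eq)
  owners⊆endpoints ((_ , e) ∷ M) (there o∈)  | just _  = there (there (owners⊆endpoints M o∈))
  owners⊆endpoints ((_ , e) ∷ M) o∈          | nothing = there (there (owners⊆endpoints M o∈))

  private
    source∉rest : ∀ {u v} {xs : List (Vertex n m)} → Unique (u ∷ v ∷ xs) → u ∉ xs
    source∉rest uq = Unique[x∷xs]⇒x∉xs uq ∘ there

    unique-rest : ∀ {u v} {xs : List (Vertex n m)} → Unique (u ∷ v ∷ xs) → Unique xs
    unique-rest (_ ∷ _ ∷ uq) = uq

  owners-unique : ∀ M → Unique (endpoints M) → Unique (owners M)
  owners-unique []            _  = []
  owners-unique ((_ , e) ∷ M) uq with owner e in eq
  ... | nothing = owners-unique M (unique-rest uq)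
  ... | just _  = ¬Any⇒All¬ (owners M) owner∉ ∷ owners-unique M (unique-rest uq)
    where
    owner∉ = λ o∈ →
      source∉rest uq (subst (_∈ endpoints M) (owner-source e eq) (owners⊆endpoints M o∈))

  weight-balance : ∀ M → matchingWeight M +ℤ + unownedCount M ≡ + length (owners M)
  weight-balance []            = refl
  weight-balance ((_ , e) ∷ M) with owner e in eq
  ... | just _  rewrite weight-owned e eq =
    trans (+-assoc (+ 1) (matchingWeight M) _) (cong (+ 1 +ℤ_) (weight-balance M))
  ... | nothing rewrite weight-unowned e eq =
    trans (-1+x+[1+y]≡x+y (matchingWeight M) _) (weight-balance M)
    where
    -1+x+[1+y]≡x+y : ∀ x y → (-[1+ 0 ] +ℤ x) +ℤ (+ 1 +ℤ y) ≡ x +ℤ y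
    -1+x+[1+y]≡x+y = solve-∀

  literal⇒variable : ∀ M {s i} → unownedCount M ≡ 0 →
                     lit s i ∈ endpoints M → var i ∈ endpoints M
  literal⇒variable ((_ , e) ∷ M) none l∈ with owner e in eq
  ... | nothing = contradiction none λ ()
  ... | just _ with l∈
  ...   | here l≡u         = contradiction l≡u (owned-source-not-literal e eq)
  ...   | there (here l≡v) = here (owned-literal-source e eq l≡v)
  ...   | there (there l∈′) = there (there (literal⇒variable M none l∈′))

  literal-twin-uncovered : ∀ M {u v o s t i} (e : Edge C u v) → owner e ≡ just o →
                           Unique (u ∷ v ∷ endpoints M) → unownedCount M ≡ 0 →
                           lit s i ≡ v → lit t i ∉ endpoints M
  literal-twin-uncovered M e eq uq none l≡v l′∈ =
    source∉rest uq
      (subst (_∈ endpoints M) (owned-literal-source e eq l≡v) (literal⇒variable M none l′∈))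

  literal-sign-unique : ∀ {M s t i} → Unique (endpoints M) → unownedCount M ≡ 0 →
                        lit s i ∈ endpoints M → lit t i ∈ endpoints M → s ≡ t
  literal-sign-unique {(_ , e) ∷ M} uq none p q with owner e in eq
  ... | nothing = contradiction none λ ()
  ... | just _ with p | q
  ...   | here s≡u          | _                 = contradiction s≡u (owned-source-not-literal e eq)
  ...   | _                 | here t≡u          = contradiction t≡u (owned-source-not-literal e eq)
  ...   | there (here refl) | there (here refl) = refl
  ...   | there (here s≡v)  | there (there q′)  =
    contradiction q′ (literal-twin-uncovered M e eq uq none s≡v)
  ...   | there (there p′)  | there (here t≡v)  =
    contradiction p′ (literal-twin-uncovered M e eq uq none t≡v)
  ...   | there (there p′)  | there (there q′)  = literal-sign-unique {M} (unique-rest uq) none p′ q′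

  weight≡n+m⇒unowned≡0∧covered : ∀ {M} → Unique (endpoints M) → matchingWeight M ≡ + (n + m) →
                                  unownedCount M ≡ 0 × (∀ o → ownerVertex o ∈ endpoints M)
  weight≡n+m⇒unowned≡0∧covered {M} uq w = unowned≡0 , covered
    where
    ι : (Fin n ⊎ Fin m) ↣ Fin (n + m)
    ι = ↔⇒↣ (↔-sym +↔⊎)

    balance : n + m + unownedCount M ≡ length (owners M)
    balance = +-injective
      (subst (λ x → x +ℤ + unownedCount M ≡ + length (owners M)) w (weight-balance M))

    owners≤ : length (owners M) ≤ n + m
    owners≤ = Unique⇒length≤ ι (owners-unique M uq)

    unowned≡0 : unownedCount M ≡ 0
    unowned≡0 = n≤0⇒n≡0 (+-cancelˡ-≤ (n + m) _ 0 (begin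
      n + m + unownedCount M  ≡⟨ balance ⟩
      length (owners M)       ≤⟨ owners≤ ⟩
      n + m                   ≡⟨ +-identityʳ (n + m) ⟨
      n + m + 0               ∎))
      where open ≤-Reasoning

    owners-full : length (owners M) ≡ n + m
    owners-full = ≤-antisym owners≤ (subst (n + m ≤_) balance (m≤m+n (n + m) _))

    covered : ∀ o → ownerVertex o ∈ endpoints M
    covered o = owners⊆endpoints M (Unique∧length≡⇒∈ ι (owners-unique M uq) owners-full o)

  induced-source : ∀ {S : Vertex n m → Set} {u w} → InducedPath C S u w → S u
  induced-source (here u∈)     = u∈
  induced-source (step u∈ _ _) = u∈

  clause-path-hits-literal : ∀ {S : Vertex n m → Set} {s j i} → InducedPath C S (cl s j) (var i) →
                             ∃ λ k → S (litVertex (lookupᵛ (C j) k))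
  clause-path-hits-literal (step _ (inj₁ (cl-cl j))      path) = clause-path-hits-literal path
  clause-path-hits-literal (step _ (inj₂ (cl-cl j))      path) = clause-path-hits-literal path
  clause-path-hits-literal (step _ (inj₁ (cl-lit j k s)) path) = k , induced-source path

  open DecMembership (_≟ᵛ_ {n} {m}) using (_∈?_)

  assignment : List (EdgeOf C) → Fin n → Bool
  assignment M i = does (lit true i ∈? endpoints M)

  covered-literal-true : ∀ {M} → Unique (endpoints M) → unownedCount M ≡ 0 →
                         ∀ l → litVertex l ∈ endpoints M → LitTrue (assignment M) l
  covered-literal-true {M} uq none (true , i)  l∈ = dec-true (lit true i ∈? endpoints M) l∈
  covered-literal-true {M} uq none (false , i) l∈ =
    dec-false (lit true i ∈? endpoints M) λ t∈ →
      contradiction (literal-sign-unique {M} uq none t∈ l∈) λ ()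

lemma2 : (n m : ℕ) (C : Instance n m) (M : List (EdgeOf C)) →
         ConnectedMatching M → matchingWeight M ≡ + (n + m) →
         Satisfiable C
lemma2 n m C M (uq , connected) w with weight≡n+m⇒unowned≡0∧covered {M = M} uq w
... | none , covered = assignment M , satisfied
  where
  satisfied : Satisfies (assignment M) C
  satisfied j =
    -- any covered x_i would do; c_j supplies one without assuming n > 0
    let i        = proj₂ (lookupᵛ (C j) zero)
        (k , l∈) = clause-path-hits-literal
                     (connected (cl true j) (var i) (covered (inj₂ j)) (covered (inj₁ i)))
    in  k , covered-literal-true {M = M} uq none (lookupᵛ (C j) k) l∈
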